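{- Let $P\subseteq S_n$ be a permutation array with ${\rm hd}(P) = d$ and $|P^{\mathsf{CT}}| \geq 2$. Then ${\rm hd}\big(P^{\mathsf{CT}}\big) > {\rm hd}(P)$ if and only if both of the following conditions hold: (1) any $\sigma, \tau \in P$ with ${\rm hd}(\sigma,\tau) = d$ satisfy $\sigma^{\mathsf{CT}} = \tau^{\mathsf{CT}}$; and (2) any $\sigma,\tau \in P$ with ${\rm hd}(\sigma, \tau) > d$ satisfy ${\rm hd}\big(\sigma^{\mathsf{CT}}, \tau^{\mathsf{CT}}\big) > d$ or $\sigma^{\mathsf{CT}} = \tau^{\mathsf{CT}}$.
   Context: $S_n$ is the symmetric group on $\{0,1,\ldots,n-1\}$. A permutation array is a non-empty subset of $S_n$. The Hamming distance of $\sigma,\tau\in S_n$ is ${\rm hd}(\sigma,\tau)=|\{x: \sigma(x)\neq\tau(x)\}|$, and for a permutation array $P$, ${\rm hd}(P)=\min\{{\rm hd}(\sigma,\tau):\sigma,\tau\in P,\ \sigma\ne\tau\}$. The contraction of $\sigma\in S_n$ is the permutation $\sigma^{\mathsf{CT}}\in S_{n-1}$ (on $\{0,\ldots,n-2\}$) defined by $\sigma^{\mathsf{CT}}(x)=\sigma(n-1)$ if $x=\sigma^{ -1}(n-1)$ and $\sigma^{\mathsf{CT}}(x)=\sigma(x)$ otherwise (i.e. delete $n-1$ from the cycle notation of $\sigma$), and $P^{\mathsf{CT}}:=\{\sigma^{\mathsf{CT}}:\sigma\in P\}$. -}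

module Defs where

open import Data.Nat using (ℕ; zero; suc; _⊓_)
open import Data.Nat.Properties using () renaming (_≟_ to _≟ℕ_)
open import Data.Fin using (Fin; fromℕ; inject₁; punchOut; _≟_)
open import Data.Fin.Properties using (fromℕ≢inject₁)
open import Data.Fin.Permutation using (Permutation′; _⟨$⟩ʳ_; _⟨$⟩ˡ_; inverseˡ)
open import Data.List using (List; []; _∷_; length; filter; map; concatMap; foldr; allFin)
open import Relation.Nullary using (yes; no; ¬?)
open import Relation.Binary.PropositionalEquality using (_≡_; _≢_; refl; sym; trans; cong)

Fun : ℕ → Set
Fun k = Fin k → Fin k

hd : ∀ {k} → Fun k → Fun k → ℕ
hd {k} f g = length (filter (λ x → ¬? (f x ≟ g x)) (allFin k))

-- hd of an array (list) of maps: minimum of hd(σ,τ) over pairs with σ ≠ τ.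
-- σ ≠ τ (as maps of Fin k) is decided by hd σ τ ≠ 0.  The fold starts at k,
-- which is an upper bound for any distance, so it is the true minimum whenever
-- the array contains two distinct elements.
hdArr : ∀ {k} → List (Fun k) → ℕ
hdArr {k} L =
  foldr _⊓_ k
    (filter (λ d → ¬? (d ≟ℕ 0))
      (concatMap (λ f → map (λ g → hd f g) L) L))

-- Contraction σ^CT ∈ S_m of σ ∈ S_{m+1}: delete the point m (= fromℕ m) from the
-- cycle notation, i.e. σ^CT x = σ m if σ x = m, and σ x otherwise.
-- Values ≠ m of Fin (suc m) are identified with Fin m via punchOut at m.
ct : ∀ {m} → Permutation′ (suc m) → Fun m
ct {m} σ x with σ ⟨$⟩ʳ inject₁ x ≟ fromℕ m
... | no ne = punchOut {i = fromℕ m} (λ e → ne (sym e))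
... | yes eq = punchOut {i = fromℕ m} {j = σ ⟨$⟩ʳ fromℕ m} bad
  where
  bad : fromℕ m ≢ σ ⟨$⟩ʳ fromℕ m
  bad e = fromℕ≢inject₁ (trans (sym (inverseˡ σ)) (trans (cong (σ ⟨$⟩ˡ_) (trans (sym e) (sym eq))) (inverseˡ σ)))

⟦_⟧ : ∀ {k} → Permutation′ k → Fun k
⟦ σ ⟧ x = σ ⟨$⟩ʳ x

CT : ∀ {m} → List (Permutation′ (suc m)) → List (Fun m)
CT P = map ct P

-- A point x where the contractions of σ and τ differ is either a point where σ and τ
-- differ, or the unique x with σ x = n-1, at which σ^CT x = σ (n-1) and τ^CT x = τ (n-1)
-- must differ; charging it to the point n-1 shows hd(σ^CT, τ^CT) ≤ hd(σ, τ).  Hence every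
-- distinct pair of P^CT lies above d unless it comes from a pair at distance d, or from a
-- farther pair whose contraction falls to distance ≤ d, and these are what (1) and (2) exclude.
module Submission where

open import Defs
open import Data.Bool using (true; false; if_then_else_)
open import Data.Fin using (Fin; zero; suc; fromℕ; inject₁; _≟_)
open import Data.Fin.Properties using (punchOut-cong; inject₁-injective; suc-injective; 0≢1+n)
open import Data.Fin.Permutation using (Permutation′)
open import Data.List using (List; map; concatMap; filter; foldr; tabulate; length; allFin)
open import Data.List.Membership.Propositional using (_∈_)
open import Data.List.Membership.Propositional.Properties
  using (∈-map⁺; ∈-map⁻; ∈-filter⁺; ∈-filter⁻; ∈-concat⁺′; ∈-concat⁻′; ∈-allFin; ∈-length;
         foldr-selective)
open import Data.List.Properties using (length-filter; length-tabulate; filter-none; foldr-forcesᵇ)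
import Data.List.Relation.Unary.All as All
open import Data.List.Relation.Unary.All.Properties using (tabulate⁺)
open import Data.Nat using (ℕ; zero; suc; _+_; _≤_; _<_; _>_; _⊓_; z≤n)
open import Data.Nat.Properties
  using (≤-refl; ≤-trans; ≤-reflexive; <-≤-trans; <⇒≱; <⇒≢; n≮0; m≤m+n; m≤n+m; +-mono-≤;
         +-assoc; +-0-monoid; +-commutativeSemigroup; _≤?_; ≰⇒>; ≮⇒≥; ⊓-sel;
         m≤n⊓o⇒m≤n; m≤n⊓o⇒m≤o; m≤n⇒m<n∨m≡n; module ≤-Reasoning)
  renaming (_≟_ to _≟ℕ_)
open import Data.Product using (_×_; ∃₂; _,_)
open import Data.Sum using (_⊎_; inj₁; inj₂)
open import Function using (_∘_; id)
open import Function.Bundles using (_⇔_; mk⇔; Injection)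
open import Function.Properties.Inverse using (↔⇒↣)
open import Relation.Nullary using (Dec; ¬_; yes; no; does; ¬?; contradiction)
open import Relation.Unary using (Pred; Decidable)
open import Relation.Binary.PropositionalEquality using (_≡_; _≢_; _≗_; refl; sym; trans; cong)
open import Algebra.Properties.CommutativeSemigroup +-commutativeSemigroup using (xy∙z≈xz∙y)
open import Algebra.Properties.Monoid.Sum +-0-monoid using (sum; sum-init-last)

sum-mono-≤ : ∀ {k} {f g : Fin k → ℕ} → (∀ i → f i ≤ g i) → sum f ≤ sum g
sum-mono-≤ {zero}  _   = z≤n
sum-mono-≤ {suc k} f≤g = +-mono-≤ (f≤g zero) (sum-mono-≤ (f≤g ∘ suc))

sum-mono-≤-except-one : ∀ {k} {f g : Fin k → ℕ} {c} →
  (∀ i → f i ≤ g i + c) → (∀ i j → g i < f i → g j < f j → i ≡ j) →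
  sum f ≤ sum g + c
sum-mono-≤-except-one {zero} _ _ = z≤n
sum-mono-≤-except-one {suc k} {f} {g} {c} f≤g+c atMostOne with f zero ≤? g zero
... | yes f₀≤g₀ = begin
  f zero + sum (f ∘ suc)       ≤⟨ +-mono-≤ f₀≤g₀ (sum-mono-≤-except-one (f≤g+c ∘ suc) atMostOneInTail) ⟩
  g zero + (sum (g ∘ suc) + c) ≡⟨ sym (+-assoc (g zero) _ c) ⟩
  g zero + sum (g ∘ suc) + c   ∎
  where
  open ≤-Reasoning
  atMostOneInTail : ∀ i j → g (suc i) < f (suc i) → g (suc j) < f (suc j) → i ≡ j
  atMostOneInTail i j gᵢ<fᵢ gⱼ<fⱼ = suc-injective (atMostOne _ _ gᵢ<fᵢ gⱼ<fⱼ)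
... | no f₀≰g₀ = begin
  f zero + sum (f ∘ suc)     ≤⟨ +-mono-≤ (f≤g+c zero) (sum-mono-≤ tail≤) ⟩
  g zero + c + sum (g ∘ suc) ≡⟨ xy∙z≈xz∙y (g zero) c _ ⟩
  g zero + sum (g ∘ suc) + c ∎
  where
  open ≤-Reasoning
  tail≤ : ∀ i → f (suc i) ≤ g (suc i)
  tail≤ i = ≮⇒≥ λ gᵢ<fᵢ → 0≢1+n (atMostOne _ _ (≰⇒> f₀≰g₀) gᵢ<fᵢ)

indicator : ∀ {p} {A : Set p} → Dec A → ℕ
indicator A? = if does A? then 1 else 0

length-filter-tabulate : ∀ {a p} {A : Set a} {P : Pred A p} (P? : Decidable P) {k} (h : Fin k → A) →
  length (filter P? (tabulate h)) ≡ sum (λ i → indicator (P? (h i)))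
length-filter-tabulate P? {zero}  h = refl
length-filter-tabulate P? {suc k} h with does (P? (h zero))
... | true  = cong suc (length-filter-tabulate P? (h ∘ suc))
... | false = length-filter-tabulate P? (h ∘ suc)

module _ {k} (f g : Fun k) where

  differs? : Decidable (λ x → f x ≢ g x)
  differs? x = ¬? (f x ≟ g x)

  differ : Fin k → ℕ
  differ x = indicator (differs? x)

  hd≡sum-differ : hd f g ≡ sum differ
  hd≡sum-differ = length-filter-tabulate differs? id

  differ-≢ : ∀ {x} → f x ≢ g x → differ x ≡ 1
  differ-≢ {x} fx≢gx with f x ≟ g x
  ... | yes fx≡gx = contradiction fx≡gx fx≢gx
  ... | no  _     = refl

  hd≤k : hd f g ≤ k
  hd≤k = ≤-trans (length-filter differs? (allFin k)) (≤-reflexive (length-tabulate id))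

  hd≡0⇒≗ : hd f g ≡ 0 → f ≗ g
  hd≡0⇒≗ hd≡0 x with f x ≟ g x
  ... | yes fx≡gx = fx≡gx
  ... | no  fx≢gx = contradiction (sym hd≡0) (<⇒≢ (∈-length (∈-filter⁺ differs? (∈-allFin x) fx≢gx)))

  ≗⇒hd≡0 : f ≗ g → hd f g ≡ 0
  ≗⇒hd≡0 f≗g = cong length (filter-none differs? (tabulate⁺ λ x fx≢gx → fx≢gx (f≗g x)))

module _ {m} (σ τ : Permutation′ (suc m)) where

  private
    top : Fin (suc m)
    top = fromℕ m

  ct-agrees : ∀ x → ⟦ σ ⟧ (inject₁ x) ≡ ⟦ τ ⟧ (inject₁ x) →
    (⟦ σ ⟧ (inject₁ x) ≡ top → ⟦ σ ⟧ top ≡ ⟦ τ ⟧ top) → ct σ x ≡ ct τ x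
  ct-agrees x σx≡τx σx≡top⇒σtop≡τtop with ⟦ σ ⟧ (inject₁ x) ≟ top | ⟦ τ ⟧ (inject₁ x) ≟ top
  ... | no  _      | no  _      = punchOut-cong top σx≡τx
  ... | yes σx≡top | no  τx≢top = contradiction (trans (sym σx≡τx) σx≡top) τx≢top
  ... | no  σx≢top | yes τx≡top = contradiction (trans σx≡τx τx≡top) σx≢top
  ... | yes σx≡top | yes _      = punchOut-cong top (σx≡top⇒σtop≡τtop σx≡top)

  ct-cong : ⟦ σ ⟧ ≗ ⟦ τ ⟧ → ct σ ≗ ct τ
  ct-cong σ≗τ x = ct-agrees x (σ≗τ _) (λ _ → σ≗τ top)

  ct-disagrees : ∀ {x} → ct σ x ≢ ct τ x →
    ⟦ σ ⟧ (inject₁ x) ≢ ⟦ τ ⟧ (inject₁ x) ⊎ (⟦ σ ⟧ (inject₁ x) ≡ top × ⟦ σ ⟧ top ≢ ⟦ τ ⟧ top)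
  ct-disagrees {x} ctσx≢ctτx with ⟦ σ ⟧ (inject₁ x) ≟ ⟦ τ ⟧ (inject₁ x)
  ... | no σx≢τx  = inj₁ σx≢τx
  ... | yes σx≡τx = inj₂ (hitsTop (⟦ σ ⟧ (inject₁ x) ≟ top) (⟦ σ ⟧ top ≟ ⟦ τ ⟧ top))
    where
    agrees : (⟦ σ ⟧ (inject₁ x) ≡ top → ⟦ σ ⟧ top ≡ ⟦ τ ⟧ top) → ct σ x ≡ ct τ x
    agrees = ct-agrees x σx≡τx
    hitsTop : Dec (⟦ σ ⟧ (inject₁ x) ≡ top) → Dec (⟦ σ ⟧ top ≡ ⟦ τ ⟧ top) →
      ⟦ σ ⟧ (inject₁ x) ≡ top × ⟦ σ ⟧ top ≢ ⟦ τ ⟧ top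
    hitsTop (no σx≢top)  _               =
      contradiction (agrees (λ σx≡top → contradiction σx≡top σx≢top)) ctσx≢ctτx
    hitsTop (yes _)      (yes σtop≡τtop) = contradiction (agrees (λ _ → σtop≡τtop)) ctσx≢ctτx
    hitsTop (yes σx≡top) (no σtop≢τtop)  = σx≡top , σtop≢τtop

  differ-ct≤ : ∀ x → differ (ct σ) (ct τ) x ≤ differ ⟦ σ ⟧ ⟦ τ ⟧ (inject₁ x) + differ ⟦ σ ⟧ ⟦ τ ⟧ top
  differ-ct≤ x with ct σ x ≟ ct τ x
  ... | yes _ = z≤n
  ... | no ctσx≢ctτx with ct-disagrees ctσx≢ctτx
  ...   | inj₁ σx≢τx           = ≤-trans (≤-reflexive (sym (differ-≢ ⟦ σ ⟧ ⟦ τ ⟧ σx≢τx))) (m≤m+n _ _)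
  ...   | inj₂ (_ , σtop≢τtop) = ≤-trans (≤-reflexive (sym (differ-≢ ⟦ σ ⟧ ⟦ τ ⟧ σtop≢τtop))) (m≤n+m _ _)

  differ-ct>⇒hits-top : ∀ x → differ ⟦ σ ⟧ ⟦ τ ⟧ (inject₁ x) < differ (ct σ) (ct τ) x →
    ⟦ σ ⟧ (inject₁ x) ≡ top
  differ-ct>⇒hits-top x differ< with ct σ x ≟ ct τ x
  ... | yes _ = contradiction differ< n≮0
  ... | no ctσx≢ctτx with ct-disagrees ctσx≢ctτx
  ...   | inj₁ σx≢τx        = contradiction (differ-≢ ⟦ σ ⟧ ⟦ τ ⟧ σx≢τx) (<⇒≢ differ<)
  ...   | inj₂ (σx≡top , _) = σx≡top

  hd-ct≤hd : hd (ct σ) (ct τ) ≤ hd ⟦ σ ⟧ ⟦ τ ⟧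
  hd-ct≤hd = begin
    hd (ct σ) (ct τ)           ≡⟨ hd≡sum-differ (ct σ) (ct τ) ⟩
    sum (differ (ct σ) (ct τ)) ≤⟨ sum-mono-≤-except-one differ-ct≤ atMostOneExcess ⟩
    sum (δ ∘ inject₁) + δ top  ≡⟨ sym (sum-init-last δ) ⟩
    sum δ                      ≡⟨ sym (hd≡sum-differ ⟦ σ ⟧ ⟦ τ ⟧) ⟩
    hd ⟦ σ ⟧ ⟦ τ ⟧             ∎
    where
    open ≤-Reasoning
    δ : Fin (suc m) → ℕ
    δ = differ ⟦ σ ⟧ ⟦ τ ⟧
    atMostOneExcess : ∀ x y → δ (inject₁ x) < differ (ct σ) (ct τ) x →
      δ (inject₁ y) < differ (ct σ) (ct τ) y → x ≡ y
    atMostOneExcess x y δx< δy< = inject₁-injective (Injection.injective (↔⇒↣ σ)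
      (trans (differ-ct>⇒hits-top x δx<) (sym (differ-ct>⇒hits-top y δy<))))

foldr-⊓-≤ : ∀ e {xs : List ℕ} {y} → y ∈ xs → foldr _⊓_ e xs ≤ y
foldr-⊓-≤ e {xs} = All.lookup (foldr-forcesᵇ ⊓-bounds e xs ≤-refl)
  where
  ⊓-bounds : ∀ x y → foldr _⊓_ e xs ≤ x ⊓ y → foldr _⊓_ e xs ≤ x × foldr _⊓_ e xs ≤ y
  ⊓-bounds x y ≤x⊓y = m≤n⊓o⇒m≤n x y ≤x⊓y , m≤n⊓o⇒m≤o x y ≤x⊓y

module _ {k} (L : List (Fun k)) where

  private
    distances : List ℕ
    distances = concatMap (λ f → map (hd f) L) L

    nonzero? : Decidable (_≢ 0)
    nonzero? d = ¬? (d ≟ℕ 0)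

    nonzero-distance : ∀ {d} → d ∈ filter nonzero? distances →
      ∃₂ λ f g → f ∈ L × g ∈ L × ¬ f ≗ g × d ≡ hd f g
    nonzero-distance d∈ with ∈-filter⁻ nonzero? d∈
    ... | d∈distances , d≢0 with ∈-concat⁻′ (map (λ f → map (hd f) L) L) d∈distances
    ... | _ , d∈row , row∈ with ∈-map⁻ (λ f → map (hd f) L) row∈
    ... | f , f∈ , refl with ∈-map⁻ (hd f) d∈row
    ... | g , g∈ , refl = f , g , f∈ , g∈ , (λ f≗g → d≢0 (≗⇒hd≡0 f g f≗g)) , refl

  ≗⊎hdArr≤hd : ∀ {f g} → f ∈ L → g ∈ L → f ≗ g ⊎ hdArr L ≤ hd f g
  ≗⊎hdArr≤hd {f} {g} f∈ g∈ with hd f g ≟ℕ 0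
  ... | yes hd≡0 = inj₁ (hd≡0⇒≗ f g hd≡0)
  ... | no  hd≢0 = inj₂ (foldr-⊓-≤ k (∈-filter⁺ nonzero? hd∈distances hd≢0))
    where
    hd∈distances : hd f g ∈ distances
    hd∈distances = ∈-concat⁺′ (∈-map⁺ (hd f) g∈) (∈-map⁺ (λ f → map (hd f) L) f∈)

  -- The distinct pair rules out the junk value k that hdArr takes when no distance is nonzero.
  <-hdArr : ∀ {n} → (∃₂ λ f g → f ∈ L × g ∈ L × ¬ f ≗ g) →
    (∀ {f g} → f ∈ L → g ∈ L → ¬ f ≗ g → n < hd f g) → n < hdArr L
  <-hdArr (f₀ , g₀ , f₀∈ , g₀∈ , f₀≉g₀) n<hd with foldr-selective ⊓-sel k (filter nonzero? distances)
  ... | inj₁ hdArr≡k = <-≤-trans (n<hd f₀∈ g₀∈ f₀≉g₀) (≤-trans (hd≤k f₀ g₀) (≤-reflexive (sym hdArr≡k)))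
  ... | inj₂ hdArr∈ with nonzero-distance hdArr∈
  ...   | f , g , f∈ , g∈ , f≉g , hdArr≡hd = <-≤-trans (n<hd f∈ g∈ f≉g) (≤-reflexive (sym hdArr≡hd))

module _ {m} (P : List (Permutation′ (suc m))) where

  MinDistancePairsMerge : Set
  MinDistancePairsMerge = (σ τ : Permutation′ (suc m)) → σ ∈ P → τ ∈ P →
    hd ⟦ σ ⟧ ⟦ τ ⟧ ≡ hdArr (map ⟦_⟧ P) → ct σ ≗ ct τ

  LargerDistancePairsStayAbove : Set
  LargerDistancePairsStayAbove = (σ τ : Permutation′ (suc m)) → σ ∈ P → τ ∈ P →
    hd ⟦ σ ⟧ ⟦ τ ⟧ > hdArr (map ⟦_⟧ P) →
    (hd (ct σ) (ct τ) > hdArr (map ⟦_⟧ P)) ⊎ (ct σ ≗ ct τ)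

  private
    ct∈ : ∀ {σ} → σ ∈ P → ct σ ∈ CT P
    ct∈ = ∈-map⁺ ct

  hdArr-CT>⇒conditions : hdArr (CT P) > hdArr (map ⟦_⟧ P) →
    MinDistancePairsMerge × LargerDistancePairsStayAbove
  hdArr-CT>⇒conditions d<D = merge , stayAbove
    where
    merge : MinDistancePairsMerge
    merge σ τ σ∈ τ∈ hd≡d with ≗⊎hdArr≤hd (CT P) (ct∈ σ∈) (ct∈ τ∈)
    ... | inj₁ ctσ≗ctτ = ctσ≗ctτ
    ... | inj₂ D≤hd    = contradiction (≤-trans D≤hd (≤-trans (hd-ct≤hd σ τ) (≤-reflexive hd≡d))) (<⇒≱ d<D)
    stayAbove : LargerDistancePairsStayAbove
    stayAbove σ τ σ∈ τ∈ _ with ≗⊎hdArr≤hd (CT P) (ct∈ σ∈) (ct∈ τ∈)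
    ... | inj₁ ctσ≗ctτ = inj₂ ctσ≗ctτ
    ... | inj₂ D≤hd    = inj₁ (<-≤-trans d<D D≤hd)

  conditions⇒hdArr-CT> : (∃₂ λ σ τ → σ ∈ P × τ ∈ P × ¬ (ct σ ≗ ct τ)) →
    MinDistancePairsMerge × LargerDistancePairsStayAbove → hdArr (CT P) > hdArr (map ⟦_⟧ P)
  conditions⇒hdArr-CT> (σ₀ , τ₀ , σ₀∈ , τ₀∈ , ctσ₀≉ctτ₀) (merge , stayAbove) =
    <-hdArr (CT P) (ct σ₀ , ct τ₀ , ct∈ σ₀∈ , ct∈ τ₀∈ , ctσ₀≉ctτ₀) above
    where
    aboveOnContractions : ∀ {σ τ} → σ ∈ P → τ ∈ P → ¬ ct σ ≗ ct τ → hdArr (map ⟦_⟧ P) < hd (ct σ) (ct τ)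
    aboveOnContractions {σ} {τ} σ∈ τ∈ ctσ≉ctτ with ≗⊎hdArr≤hd (map ⟦_⟧ P) (∈-map⁺ ⟦_⟧ σ∈) (∈-map⁺ ⟦_⟧ τ∈)
    ... | inj₁ σ≗τ = contradiction (ct-cong σ τ σ≗τ) ctσ≉ctτ
    ... | inj₂ d≤hd with m≤n⇒m<n∨m≡n d≤hd
    ...   | inj₂ d≡hd = contradiction (merge σ τ σ∈ τ∈ (sym d≡hd)) ctσ≉ctτ
    ...   | inj₁ d<hd with stayAbove σ τ σ∈ τ∈ d<hd
    ...     | inj₁ d<hd-ct   = d<hd-ct
    ...     | inj₂ ctσ≗ctτ   = contradiction ctσ≗ctτ ctσ≉ctτ
    above : ∀ {f g} → f ∈ CT P → g ∈ CT P → ¬ f ≗ g → hdArr (map ⟦_⟧ P) < hd f g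
    above f∈ g∈ with ∈-map⁻ ct f∈ | ∈-map⁻ ct g∈
    ... | σ , σ∈ , refl | τ , τ∈ , refl = aboveOnContractions σ∈ τ∈

theorem3p3 : (m : ℕ) (P : List (Permutation′ (suc m))) →
    (∃₂ λ σ τ → σ ∈ P × τ ∈ P × ¬ (ct σ ≗ ct τ)) →
    (hdArr (CT P) > hdArr (map ⟦_⟧ P)
      ⇔ (((σ τ : Permutation′ (suc m)) → σ ∈ P → τ ∈ P →
            hd ⟦ σ ⟧ ⟦ τ ⟧ ≡ hdArr (map ⟦_⟧ P) → ct σ ≗ ct τ)
         × ((σ τ : Permutation′ (suc m)) → σ ∈ P → τ ∈ P →
            hd ⟦ σ ⟧ ⟦ τ ⟧ > hdArr (map ⟦_⟧ P) →
            (hd (ct σ) (ct τ) > hdArr (map ⟦_⟧ P)) ⊎ (ct σ ≗ ct τ))))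
theorem3p3 m P distinctContractions =
  mk⇔ (hdArr-CT>⇒conditions P) (conditions⇒hdArr-CT> P distinctContractions)
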